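{- Let $k\ge 0$ be an integer and let $a=(a_1,a_2,\dots)$ be the infinite $(0,1)$-vector with $a_1=\cdots=a_k=1$ and $a_j=0$ for all $j>k$. Then for all finite permutations $\sigma,\tau$, we have $\sigma\in_a\tau$ if and only if $\sigma\leq_a\tau$.
   Context: Permutations are written in one-line notation. For a permutation $\sigma$ of length $m$ and a permutation $\tau=\tau_1\cdots\tau_n$, we write $\sigma\in_a\tau$ if there are positions $1\le i_1<i_2<\cdots<i_m\le n$ such that $\tau_{i_1}\cdots\tau_{i_m}$ is order-isomorphic to $\sigma$ (i.e. $\tau_{i_s}<\tau_{i_t}$ iff $\sigma_s<\sigma_t$) and, for every $j\in\{1,\dots,m-1\}$ with $a_j=0$, we have $i_{j+1}=i_j+1$. Define a covering relation: for permutations $\rho$ of length $n-1$ and $\pi$ of length $n$, $\rho\prec_a\pi$ iff $\rho\in_a\pi$. The relation $\leq_a$ is the reflexive and transitive closure of $\prec_a$. -}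

module Defs where

open import Data.Nat using (ℕ; zero; suc; _≤ᵇ_)
open import Data.Bool using (Bool; true; false)
open import Data.Fin using (Fin; toℕ) renaming (_<_ to _<ᶠ_)
open import Data.Vec using (Vec; lookup)
open import Data.Product using (Σ; ∃; _×_; _,_)
open import Function.Bundles using (_⇔_)
open import Relation.Binary.PropositionalEquality using (_≡_)
open import Relation.Binary.Construct.Closure.ReflexiveTransitive using (Star)

-- A (finite) permutation of length n in one-line notation: a vector of
-- length n with entries in Fin n (values 0..n-1 instead of 1..n, which is
-- irrelevant for order-isomorphism) whose entries are pairwise distinct.
IsPerm : ∀ {n} → Vec (Fin n) n → Set
IsPerm {n} v = ∀ (x y : Fin n) → lookup v x ≡ lookup v y → x ≡ y

-- An infinite (0,1)-vector a = (a_1, a_2, ...), given as a function on ℕ;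
-- only the values at indices j ≥ 1 are used (true = 1, false = 0).
01Vec : Set
01Vec = ℕ → Bool

onesUpTo : ℕ → 01Vec
onesUpTo k j = j ≤ᵇ k

-- σ ∈_a τ : an occurrence of σ in τ at strictly increasing positions
-- i_1 < ... < i_m, order-isomorphic to σ, with i_{j+1} = i_j + 1 whenever
-- a_j = 0 (position s : Fin m corresponds to the 1-based index toℕ s + 1).
record Occurs (a : 01Vec) {m n : ℕ} (σ : Vec (Fin m) m) (τ : Vec (Fin n) n) : Set where
  field
    pos        : Fin m → Fin n
    increasing : ∀ (s t : Fin m) → s <ᶠ t → pos s <ᶠ pos t
    orderIso   : ∀ (s t : Fin m) →
                 (lookup τ (pos s) <ᶠ lookup τ (pos t)) ⇔ (lookup σ s <ᶠ lookup σ t)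
    adjacent   : ∀ (s t : Fin m) → toℕ t ≡ suc (toℕ s) →
                 a (suc (toℕ s)) ≡ false → toℕ (pos t) ≡ suc (toℕ (pos s))

_∈[_]_ : ∀ {m n} → Vec (Fin m) m → 01Vec → Vec (Fin n) n → Set
σ ∈[ a ] τ = Occurs a σ τ

AnyLen : Set
AnyLen = Σ ℕ (λ n → Vec (Fin n) n)

data _≺[_]_ : AnyLen → 01Vec → AnyLen → Set where
  cover : ∀ {a} {m} {ρ : Vec (Fin m) m} {π : Vec (Fin (suc m)) (suc m)} →
          IsPerm ρ → IsPerm π → ρ ∈[ a ] π → (m , ρ) ≺[ a ] (suc m , π)

_≤[_]_ : AnyLen → 01Vec → AnyLen → Set
x ≤[ a ] y = Star (λ u v → u ≺[ a ] v) x y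

module Submission where

-- (⇐) An a-occurrence of σ in ρ followed by one of ρ in τ composes to an
--     a-occurrence of σ in τ, because positions only move right under an
--     increasing embedding and the zeros of a are upward closed.  Induction
--     along the chain of covers then gives σ ∈_a τ.
-- (⇒) By induction on the length of τ.  If |σ| = |τ| the embedding is the
--     identity and order-isomorphism forces τ = σ.  Otherwise τ has a
--     position d (counted from 0) not used by the occurrence with d ≤ k or
--     d the last position: the first position moved by the embedding, or
--     the last one if none is moved.  Deleting d from τ (and standardising) yields ρ with
--     σ ∈_a ρ and ρ ≺_a τ; removing such a d never separates two entries
--     that must stay adjacent.

open import Defs
open import Data.Nat using (ℕ)
open import Data.Fin using (Fin)
open import Data.Vec using (Vec)
open import Data.Product using (_,_)
open import Function.Bundles using (_⇔_)

open import Data.Nat using (zero; suc; _≤_; _<_; z≤n; s≤s; s≤s⁻¹; _≤ᵇ_; _≟_)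
open import Data.Nat.Properties
  using (≤-refl; ≤-reflexive; <-irrefl; ≤-antisym; ≤-<-trans; <-≤-trans; ≤⇒≤ᵇ; ≤ᵇ⇒≤; <⇒≱; ≰⇒>; ≮⇒≥; ≤∧≢⇒<;
         n≤0⇒n≡0; 1+n≰n; m≤n⇒m≤1+n; suc-injective; module ≤-Reasoning)
open import Data.Bool using (true; false; T)
open import Data.Bool.Properties using (T-≡)
open import Data.Unit using (tt)
open import Data.Fin using (toℕ; fromℕ; fromℕ<; inject; inject₁; inject≤; punchIn; punchOut)
  renaming (_<_ to _<ᶠ_)
open import Data.Fin.Properties
  using (toℕ-injective; toℕ<n; toℕ-fromℕ; toℕ-fromℕ<; toℕ-inject; toℕ-inject₁; toℕ-inject≤; ≤̄⇒inject₁<;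
         any?; all?; ¬∀⟶∃¬-smallest; injective⇒≤;
         punchInᵢ≢i; punchIn-injective; punchIn-cancel-≤; punchOut-injective; punchOut-cong;
         punchOut-mono-≤; punchOut-cancel-≤; punchIn-punchOut; punchOut-punchIn)
  renaming (<-cmp to <ᶠ-cmp; <-irrefl to <ᶠ-irrefl; <-asym to <ᶠ-asym; _≟_ to _≟ᶠ_)
open import Data.Vec using (lookup; tabulate)
open import Data.Vec.Properties using (lookup∘tabulate; tabulate∘lookup; tabulate-cong)
open import Data.Product using (∃; _×_; proj₁; proj₂)
open import Data.Sum using (_⊎_; inj₁; inj₂)
open import Function using (_∘_)
open import Function.Bundles using (mk⇔; Equivalence)
open import Function.Definitions using (Injective)
open import Function.Properties.Equivalence using () renaming (sym to ⇔-sym; trans to ⇔-trans)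
open import Relation.Binary.PropositionalEquality
open import Relation.Binary.Definitions using (tri<; tri≈; tri>)
open import Relation.Nullary using (¬_; yes; no; contradiction)
open import Relation.Unary using (Decidable)
open import Relation.Binary.Construct.Closure.ReflexiveTransitive using (ε; _◅_; _◅◅_)

open Equivalence using (to; from)
open Occurs

onesUpTo-true : ∀ {k j} → j ≤ k → onesUpTo k j ≡ true
onesUpTo-true j≤k = to T-≡ (≤⇒≤ᵇ j≤k)

onesUpTo-false : ∀ {k j} → k < j → onesUpTo k j ≡ false
onesUpTo-false {k} {j} k<j with j ≤ᵇ k in eq
... | false = refl
... | true  = contradiction (≤ᵇ⇒≤ j k (subst T (sym eq) tt)) (<⇒≱ k<j)

onesUpTo-false⇒> : ∀ {k j} → onesUpTo k j ≡ false → k < j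
onesUpTo-false⇒> a≡false = ≰⇒> (λ j≤k → subst T a≡false (≤⇒≤ᵇ j≤k))

-- Once a_i = 0, every later entry is 0.  This is what makes occurrences
-- compose (and so what makes ≤_a imply ∈_a).
ZerosUpward : 01Vec → Set
ZerosUpward a = ∀ {i j} → i ≤ j → a i ≡ false → a j ≡ false

onesUpTo-zerosUpward : ∀ k → ZerosUpward (onesUpTo k)
onesUpTo-zerosUpward k i≤j aᵢ≡0 = onesUpTo-false (<-≤-trans (onesUpTo-false⇒> aᵢ≡0) i≤j)

Increasing : ∀ {m n} → (Fin m → Fin n) → Set
Increasing p = ∀ s t → s <ᶠ t → p s <ᶠ p t

increasing⇒≥ : ∀ {m n} (p : Fin m → Fin n) → Increasing p → ∀ s → toℕ s ≤ toℕ (p s)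
increasing⇒≥ p inc Fin.zero    = z≤n
increasing⇒≥ p inc (Fin.suc s) =
  ≤-<-trans (increasing⇒≥ (p ∘ inject₁) inc∘inject₁ s) (inc (inject₁ s) (Fin.suc s) (≤̄⇒inject₁< ≤-refl))
  where
    inc∘inject₁ : Increasing (p ∘ inject₁)
    inc∘inject₁ s t s<t = inc (inject₁ s) (inject₁ t) (subst₂ _<_ (sym (toℕ-inject₁ s)) (sym (toℕ-inject₁ t)) s<t)

increasing⇒injective : ∀ {m n} {p : Fin m → Fin n} → Increasing p → Injective _≡_ _≡_ p
increasing⇒injective inc {s} {t} ps≡pt with <ᶠ-cmp s t
... | tri< s<t _ _ = contradiction (inc s t s<t) (<ᶠ-irrefl ps≡pt)
... | tri≈ _ s≡t _ = s≡t
... | tri> _ _ t<s = contradiction (inc t s t<s) (<ᶠ-irrefl (sym ps≡pt))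

increasing-reflects : ∀ {m n} {p : Fin m → Fin n} → Increasing p → ∀ {s t} → p s <ᶠ p t → s <ᶠ t
increasing-reflects inc {s} {t} ps<pt with <ᶠ-cmp s t
... | tri< s<t _ _ = s<t
... | tri≈ _ refl _ = contradiction ps<pt (<ᶠ-irrefl refl)
... | tri> _ _ t<s = contradiction (inc t s t<s) (<ᶠ-asym ps<pt)

occurrence-length : ∀ {a m n} {σ : Vec (Fin m) m} {τ : Vec (Fin n) n} → σ ∈[ a ] τ → m ≤ n
occurrence-length O = injective⇒≤ (increasing⇒injective (increasing O))

injective⇒surjective : ∀ {n} {f : Fin n → Fin n} → Injective _≡_ _≡_ f → ∀ v → ∃ λ s → f s ≡ v
injective⇒surjective {suc n} {f} f-inj v with any? (λ s → f s ≟ᶠ v)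
... | yes hit = hit
... | no miss = contradiction (injective⇒≤ squeezed-inj) 1+n≰n
  where
    v≢f : ∀ s → v ≢ f s
    v≢f s v≡fs = miss (s , sym v≡fs)
    -- f with the missed value v squeezed out: an injection Fin (suc n) → Fin n.
    squeezed-inj : Injective _≡_ _≡_ (λ s → punchOut (v≢f s))
    squeezed-inj e = f-inj (punchOut-injective (v≢f _) (v≢f _) e)

-- The only increasing endomap of Fin n is the identity: it moves positions
-- to the right, and so does its (increasing) inverse.
increasing-endo⇒id : ∀ {n} (φ : Fin n → Fin n) → Increasing φ → ∀ s → φ s ≡ s
increasing-endo⇒id φ inc s = toℕ-injective (≤-antisym φs≤s (increasing⇒≥ φ inc s))
  where
    φ-inj : Injective _≡_ _≡_ φ
    φ-inj = increasing⇒injective inc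
    ψ : Fin _ → Fin _
    ψ v = proj₁ (injective⇒surjective φ-inj v)
    φψ : ∀ v → φ (ψ v) ≡ v
    φψ v = proj₂ (injective⇒surjective φ-inj v)
    ψ-inc : Increasing ψ
    ψ-inc v w v<w = increasing-reflects inc (subst₂ _<ᶠ_ (sym (φψ v)) (sym (φψ w)) v<w)
    φs≤s : toℕ (φ s) ≤ toℕ s
    φs≤s = subst (λ x → toℕ (φ s) ≤ toℕ x) (φ-inj (φψ (φ s))) (increasing⇒≥ ψ ψ-inc (φ s))

-- A permutation is determined by its relative order: any g ordered like an
-- injective f coincides with f (g ∘ f⁻¹ is increasing, hence the identity).
ordered-alike⇒≡ : ∀ {n} (f g : Fin n → Fin n) → Injective _≡_ _≡_ f →
                  (∀ s t → f s <ᶠ f t → g s <ᶠ g t) → ∀ s → g s ≡ f s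
ordered-alike⇒≡ f g f-inj alike s = begin
  g s               ≡⟨ cong g (sym (f-inj (ff⁻¹ (f s)))) ⟩
  g (f⁻¹ (f s))     ≡⟨ increasing-endo⇒id (g ∘ f⁻¹) g∘f⁻¹-inc (f s) ⟩
  f s               ∎
  where
    open ≡-Reasoning
    f⁻¹ : Fin _ → Fin _
    f⁻¹ v = proj₁ (injective⇒surjective f-inj v)
    ff⁻¹ : ∀ v → f (f⁻¹ v) ≡ v
    ff⁻¹ v = proj₂ (injective⇒surjective f-inj v)
    g∘f⁻¹-inc : Increasing (g ∘ f⁻¹)
    g∘f⁻¹-inc v w v<w = alike _ _ (subst₂ _<ᶠ_ (sym (ff⁻¹ v)) (sym (ff⁻¹ w)) v<w)

reflects-≤⇒preserves-< : ∀ {x y u v : ℕ} → (v ≤ u → y ≤ x) → x < y → u < v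
reflects-≤⇒preserves-< reflects x<y = ≰⇒> (λ v≤u → <⇒≱ x<y (reflects v≤u))

punchIn-increasing : ∀ {n} (i : Fin (suc n)) → Increasing (punchIn i)
punchIn-increasing i j k = reflects-≤⇒preserves-< (punchIn-cancel-≤ i k j)

punchOut-<⇔ : ∀ {n} {i j k : Fin (suc n)} (i≢j : i ≢ j) (i≢k : i ≢ k) →
              (punchOut i≢j <ᶠ punchOut i≢k) ⇔ (j <ᶠ k)
punchOut-<⇔ i≢j i≢k = mk⇔ (reflects-≤⇒preserves-< (punchOut-mono-≤ i≢k i≢j))
                          (reflects-≤⇒preserves-< (punchOut-cancel-≤ i≢k i≢j))

punchIn-adjacent : ∀ {n} (i : Fin (suc n)) {s t : Fin n} → toℕ i ≢ toℕ t → toℕ t ≡ suc (toℕ s) →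
                   toℕ (punchIn i t) ≡ suc (toℕ (punchIn i s))
punchIn-adjacent Fin.zero _ t≡1+s = cong suc t≡1+s
punchIn-adjacent (Fin.suc i) {Fin.zero} {Fin.zero} _ ()
punchIn-adjacent (Fin.suc Fin.zero) {Fin.zero} {Fin.suc Fin.zero} i≢t refl = contradiction refl i≢t
punchIn-adjacent (Fin.suc (Fin.suc i)) {Fin.zero} {Fin.suc Fin.zero} _ refl = refl
punchIn-adjacent (Fin.suc i) {Fin.zero} {Fin.suc (Fin.suc t)} _ ()
punchIn-adjacent (Fin.suc i) {Fin.suc s} {Fin.zero} _ ()
punchIn-adjacent (Fin.suc i) {Fin.suc s} {Fin.suc t} i≢t t≡1+s =
  cong suc (punchIn-adjacent i (i≢t ∘ cong suc) (suc-injective t≡1+s))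

punchOut-adjacent : ∀ {n} {i j k : Fin (suc n)} (i≢j : i ≢ j) (i≢k : i ≢ k) → toℕ k ≡ suc (toℕ j) →
                    toℕ (punchOut i≢k) ≡ suc (toℕ (punchOut i≢j))
punchOut-adjacent {i = Fin.zero} {Fin.zero} i≢j _ _ = contradiction refl i≢j
punchOut-adjacent {i = Fin.zero} {Fin.suc j} {Fin.suc k} _ _ k≡1+j = suc-injective k≡1+j
punchOut-adjacent {suc n} {Fin.suc i} {Fin.zero} {Fin.zero} _ _ ()
punchOut-adjacent {suc n} {Fin.suc Fin.zero} {Fin.zero} {Fin.suc Fin.zero} _ i≢k refl = contradiction refl i≢k
punchOut-adjacent {suc (suc n)} {Fin.suc (Fin.suc i)} {Fin.zero} {Fin.suc Fin.zero} _ _ refl = refl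
punchOut-adjacent {suc n} {Fin.suc i} {Fin.zero} {Fin.suc (Fin.suc k)} _ _ ()
punchOut-adjacent {suc n} {Fin.suc i} {Fin.suc j} {Fin.zero} _ _ ()
punchOut-adjacent {suc n} {Fin.suc i} {Fin.suc j} {Fin.suc k} i≢j i≢k k≡1+j =
  cong suc (punchOut-adjacent (i≢j ∘ cong Fin.suc) (i≢k ∘ cong Fin.suc) (suc-injective k≡1+j))

occurs-refl : ∀ {a m} (σ : Vec (Fin m) m) → σ ∈[ a ] σ
occurs-refl σ = record
  { pos = λ s → s ; increasing = λ _ _ s<t → s<t
  ; orderIso = λ _ _ → mk⇔ (λ x → x) (λ x → x) ; adjacent = λ _ _ t≡1+s _ → t≡1+s }

-- Occurrences compose.  Adjacency survives because the inner embedding moves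
-- position s to pos s ≥ s, and a_{s+1} = 0 forces a_{pos s + 1} = 0.
occurs-trans : ∀ {a m p n} {σ : Vec (Fin m) m} {ρ : Vec (Fin p) p} {τ : Vec (Fin n) n} →
               ZerosUpward a → σ ∈[ a ] ρ → ρ ∈[ a ] τ → σ ∈[ a ] τ
occurs-trans zeros O₁ O₂ = record
  { pos = pos O₂ ∘ pos O₁
  ; increasing = λ s t s<t → increasing O₂ _ _ (increasing O₁ s t s<t)
  ; orderIso = λ s t → ⇔-trans (orderIso O₂ (pos O₁ s) (pos O₁ t)) (orderIso O₁ s t)
  ; adjacent = λ s t t≡1+s aₛ≡0 →
      adjacent O₂ (pos O₁ s) (pos O₁ t) (adjacent O₁ s t t≡1+s aₛ≡0)
                  (zeros (s≤s (increasing⇒≥ (pos O₁) (increasing O₁) s)) aₛ≡0) }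

≤⇒occurs : ∀ {a} → ZerosUpward a → ∀ {x y : AnyLen} → x ≤[ a ] y → proj₂ x ∈[ a ] proj₂ y
≤⇒occurs zeros ε = occurs-refl _
≤⇒occurs zeros (cover _ _ O ◅ chain) = occurs-trans zeros O (≤⇒occurs zeros chain)

-- An occurrence of a permutation σ in a word of the same length is the
-- identity embedding, so the word is σ itself.
same-length-occurrence : ∀ {a n} {σ τ : Vec (Fin n) n} → IsPerm σ → σ ∈[ a ] τ → τ ≡ σ
same-length-occurrence {σ = σ} {τ} σ-perm O = begin
  τ                      ≡⟨ sym (tabulate∘lookup τ) ⟩
  tabulate (lookup τ)    ≡⟨ tabulate-cong (ordered-alike⇒≡ (lookup σ) (lookup τ) (σ-perm _ _) τ-alike) ⟩
  tabulate (lookup σ)    ≡⟨ tabulate∘lookup σ ⟩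
  σ                      ∎
  where
    open ≡-Reasoning
    pos≡id : ∀ s → pos O s ≡ s
    pos≡id = increasing-endo⇒id (pos O) (increasing O)
    τ-alike : ∀ s t → lookup σ s <ᶠ lookup σ t → lookup τ s <ᶠ lookup τ t
    τ-alike s t σs<σt = subst₂ (λ u v → lookup τ u <ᶠ lookup τ v) (pos≡id s) (pos≡id t)
                               (from (orderIso O s t) σs<σt)

-- Position d of a word of length n+1 may be deleted without breaking a
-- required adjacency: a_d = 1 (the entries at d-1 and d+1 need not be
-- adjacent) or d is the last position.
Deletable : 01Vec → ∀ {n} → Fin (suc n) → Set
Deletable a {n} d = a (toℕ d) ≡ true ⊎ toℕ d ≡ n

module Deletion {n : ℕ} (τ : Vec (Fin (suc n)) (suc n)) (τ-perm : IsPerm τ) (d : Fin (suc n)) where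

  value-differs : ∀ {j} → d ≢ j → lookup τ d ≢ lookup τ j
  value-differs d≢j τd≡τj = d≢j (τ-perm _ _ τd≡τj)

  -- Position i of the shortened word is position punchIn d i of τ.
  skips-d : ∀ i → d ≢ punchIn d i
  skips-d i = punchInᵢ≢i d i ∘ sym

  -- τ with position d removed and its values standardised.
  entry : Fin n → Fin n
  entry i = punchOut (value-differs (skips-d i))

  ρ : Vec (Fin n) n
  ρ = tabulate entry

  lookup-ρ : ∀ {j} (d≢j : d ≢ j) → lookup ρ (punchOut d≢j) ≡ punchOut (value-differs d≢j)
  lookup-ρ d≢j = trans (lookup∘tabulate entry (punchOut d≢j))
                       (punchOut-cong (lookup τ d) (cong (lookup τ) (punchIn-punchOut d≢j)))

  ρ-perm : IsPerm ρ
  ρ-perm x y ρx≡ρy =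
    punchIn-injective d x y (τ-perm _ _ (punchOut-injective (value-differs (skips-d x)) (value-differs (skips-d y))
      (trans (sym (lookup∘tabulate entry x)) (trans ρx≡ρy (lookup∘tabulate entry y)))))

  ρ-order : ∀ {j j′} (d≢j : d ≢ j) (d≢j′ : d ≢ j′) →
            (lookup ρ (punchOut d≢j) <ᶠ lookup ρ (punchOut d≢j′)) ⇔ (lookup τ j <ᶠ lookup τ j′)
  ρ-order {j} {j′} d≢j d≢j′ =
    subst₂ (λ x y → (x <ᶠ y) ⇔ (lookup τ j <ᶠ lookup τ j′)) (sym (lookup-ρ d≢j)) (sym (lookup-ρ d≢j′))
           (punchOut-<⇔ (value-differs d≢j) (value-differs d≢j′))

  -- A deletable d is never a position t of the shortened word with a_t = 0,
  -- so the gap it leaves never splits a required adjacency.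
  deletable-gap : ∀ {a} → Deletable a d → ∀ (t : Fin n) → a (toℕ t) ≡ false → toℕ d ≢ toℕ t
  deletable-gap {a} (inj₁ a-d≡1) t aₜ≡0 d≡t = contradiction (trans (sym a-d≡1) (trans (cong a d≡t) aₜ≡0)) (λ ())
  deletable-gap     (inj₂ d≡n)   t _    d≡t = <-irrefl d≡n (subst (_< n) (sym d≡t) (toℕ<n t))

  ρ-in-τ : ∀ {a} → Deletable a d → ρ ∈[ a ] τ
  ρ-in-τ {a} deletable = record
    { pos = punchIn d ; increasing = punchIn-increasing d
    ; orderIso = λ s t →
        subst₂ (λ x y → (lookup τ (punchIn d s) <ᶠ lookup τ (punchIn d t)) ⇔ (lookup ρ x <ᶠ lookup ρ y))
               (punchOut-punchIn d) (punchOut-punchIn d)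
               (⇔-sym (ρ-order (skips-d s) (skips-d t)))
    ; adjacent = λ s t t≡1+s aₛ≡0 →
        punchIn-adjacent d (deletable-gap {a} deletable t (subst (λ x → a x ≡ false) (sym t≡1+s) aₛ≡0)) t≡1+s }

  σ-in-ρ : ∀ {a m} {σ : Vec (Fin m) m} (O : σ ∈[ a ] τ) → (∀ s → d ≢ pos O s) → σ ∈[ a ] ρ
  σ-in-ρ O unused = record
    { pos = λ s → punchOut (unused s)
    ; increasing = λ s t s<t → from (punchOut-<⇔ (unused s) (unused t)) (increasing O s t s<t)
    ; orderIso = λ s t → ⇔-trans (ρ-order (unused s) (unused t)) (orderIso O s t)
    ; adjacent = λ s t t≡1+s aₛ≡0 → punchOut-adjacent (unused s) (unused t) (adjacent O s t t≡1+s aₛ≡0) }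

Fixed : ∀ {a m n} {σ : Vec (Fin m) m} {τ : Vec (Fin n) n} → σ ∈[ a ] τ → Fin m → Set
Fixed O s = toℕ (pos O s) ≡ toℕ s

fixed? : ∀ {a m n} {σ : Vec (Fin m) m} {τ : Vec (Fin n) n} (O : σ ∈[ a ] τ) → Decidable (Fixed O)
fixed? O s = toℕ (pos O s) ≟ toℕ s

fixed-step : ∀ {a m n} {σ : Vec (Fin (suc m)) (suc m)} {τ : Vec (Fin n) n} (O : σ ∈[ a ] τ) (s : Fin m) →
             a (suc (toℕ s)) ≡ false → Fixed O (inject₁ s) → Fixed O (Fin.suc s)
fixed-step {a} O s aₛ≡0 fixed = begin
  toℕ (pos O (Fin.suc s))           ≡⟨ adjacent O (inject₁ s) (Fin.suc s) (cong suc (sym (toℕ-inject₁ s))) a′≡0 ⟩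
  suc (toℕ (pos O (inject₁ s)))     ≡⟨ cong suc (trans fixed (toℕ-inject₁ s)) ⟩
  suc (toℕ s)                       ∎
  where
    open ≡-Reasoning
    a′≡0 : a (suc (toℕ (inject₁ s))) ≡ false
    a′≡0 = subst (λ x → a (suc x) ≡ false) (sym (toℕ-inject₁ s)) aₛ≡0

all-fixed⇒last-unused : ∀ {a m n} {σ : Vec (Fin m) m} {τ : Vec (Fin (suc n)) (suc n)}
                        (O : σ ∈[ a ] τ) → m ≤ n → (∀ s → Fixed O s) → ∀ s → fromℕ n ≢ pos O s
all-fixed⇒last-unused {n = n} O m≤n all-fixed s n≡pos = <⇒≱ (<-≤-trans (toℕ<n s) m≤n) (begin
  n                 ≡⟨ trans (sym (toℕ-fromℕ n)) (cong toℕ n≡pos) ⟩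
  toℕ (pos O s)     ≡⟨ all-fixed s ⟩
  toℕ s             ∎)
  where open ≤-Reasoning

-- The first moved position s₀ is unused: earlier positions are fixed, and
-- later ones land beyond pos s₀ > s₀.
first-moved-unused : ∀ {a m n} {σ : Vec (Fin m) m} {τ : Vec (Fin n) n} (O : σ ∈[ a ] τ) (s₀ : Fin m) →
                     ¬ Fixed O s₀ → (∀ s → s <ᶠ s₀ → Fixed O s) → ∀ s → toℕ s₀ ≢ toℕ (pos O s)
first-moved-unused O s₀ moved before s s₀≡pos with <ᶠ-cmp s s₀
... | tri< s<s₀ _ _ = <⇒≱ s<s₀ (≤-reflexive (trans s₀≡pos (before s s<s₀)))
... | tri≈ _ refl _ = moved (sym s₀≡pos)
... | tri> _ _ s₀<s = <⇒≱ (≤-<-trans (increasing⇒≥ (pos O) (increasing O) s₀) (increasing O s₀ s s₀<s))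
                          (≤-reflexive (sym s₀≡pos))

-- For a = onesUpTo k the first moved position is at most k: beyond k,
-- fixed-step would fix it.
first-moved-within-ones : ∀ {k m n} {σ : Vec (Fin m) m} {τ : Vec (Fin n) n}
                          (O : σ ∈[ onesUpTo k ] τ) (s₀ : Fin m) → ¬ Fixed O s₀ → (∀ s → s <ᶠ s₀ → Fixed O s) → toℕ s₀ ≤ k
first-moved-within-ones O Fin.zero       _     _      = z≤n
first-moved-within-ones O (Fin.suc s₁) moved before =
  ≮⇒≥ (λ k<s₀ → moved (fixed-step O s₁ (onesUpTo-false k<s₀) (before (inject₁ s₁) (≤̄⇒inject₁< ≤-refl))))

-- In a strictly longer τ, an occurrence for a = onesUpTo k leaves some
-- deletable position unused: the first moved position, or the last
-- position when nothing is moved.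
unused-deletable-position : ∀ k {m n} {σ : Vec (Fin m) m} {τ : Vec (Fin (suc n)) (suc n)}
                            (O : σ ∈[ onesUpTo k ] τ) → m ≤ n →
                            ∃ λ d → (∀ s → d ≢ pos O s) × Deletable (onesUpTo k) d
unused-deletable-position k {m} {n} O m≤n with all? (fixed? O)
... | yes all-fixed = fromℕ n , all-fixed⇒last-unused O m≤n all-fixed , inj₂ (toℕ-fromℕ n)
... | no some-moved with ¬∀⟶∃¬-smallest m (Fixed O) (fixed? O) some-moved
...   | s₀ , moved , earlier =
  d , (λ s d≡pos → first-moved-unused O s₀ moved before s (trans (sym d≡s₀) (cong toℕ d≡pos))) ,
  inj₁ (onesUpTo-true (subst (_≤ k) (sym d≡s₀) (first-moved-within-ones O s₀ moved before)))
  where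
    d : Fin (suc n)
    d = inject≤ s₀ (m≤n⇒m≤1+n m≤n)
    d≡s₀ : toℕ d ≡ toℕ s₀
    d≡s₀ = toℕ-inject≤ s₀ _
    before : ∀ s → s <ᶠ s₀ → Fixed O s
    before s s<s₀ = subst (Fixed O) (toℕ-injective (trans (toℕ-inject _) (toℕ-fromℕ< s<s₀)))
                          (earlier (fromℕ< s<s₀))

occurs⇒≤ : ∀ k n {m} (σ : Vec (Fin m) m) (τ : Vec (Fin n) n) → IsPerm σ → IsPerm τ →
           σ ∈[ onesUpTo k ] τ → (m , σ) ≤[ onesUpTo k ] (n , τ)
occurs⇒≤ k n {m} σ τ σ-perm τ-perm O with m ≟ n
... | yes refl rewrite same-length-occurrence σ-perm O = ε
occurs⇒≤ k zero    σ τ σ-perm τ-perm O | no m≢0 = contradiction (n≤0⇒n≡0 (occurrence-length O)) m≢0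
occurs⇒≤ k (suc n) σ τ σ-perm τ-perm O | no m≢1+n
  with unused-deletable-position k O (s≤s⁻¹ (≤∧≢⇒< (occurrence-length O) m≢1+n))
... | d , unused , deletable =
  occurs⇒≤ k n σ ρ σ-perm ρ-perm (σ-in-ρ O unused) ◅◅ (cover ρ-perm τ-perm (ρ-in-τ deletable) ◅ ε)
  where open Deletion τ τ-perm d

proposition2p2 : ∀ (k m n : ℕ) (σ : Vec (Fin m) m) (τ : Vec (Fin n) n) →
    IsPerm σ → IsPerm τ →
    (σ ∈[ onesUpTo k ] τ) ⇔ ((m , σ) ≤[ onesUpTo k ] (n , τ))
proposition2p2 k m n σ τ σ-perm τ-perm =
  mk⇔ (occurs⇒≤ k n σ τ σ-perm τ-perm) (≤⇒occurs (onesUpTo-zerosUpward k))
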